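{- Let $q\ge 2$ be an integer, let $A\subset\mathbb{Z}_q$ be a nonempty set with $|A| \geq tq$ where $0<t<1$, and let $k$ be a positive integer. Then there are sets $B_1, \ldots, B_k \subset\mathbb{Z}_q$ such that \[ A+B_1 + \cdots + B_k = \mathbb{Z}_q \] and \[ |B_i| \leq m = \left\lceil \left( \frac{\log q}{t} \right)^{1/k} \right\rceil \quad (1\le i\le k). \]
   Context: $\mathbb{Z}_q$ denotes the group of residues modulo $q$; $\log$ is the natural logarithm; sums of sets are Minkowski sums $X+Y=\{x+y: x\in X, y\in Y\}$.
   Formalization: The parameter t with 0<t<1 and |A| ≥ tq is rational. -}

module Defs where

open import Data.Nat as ℕ using (ℕ; zero; suc; NonZero; _%_)
open import Data.Nat.DivMod using (m%n<n)
open import Data.Integer using (+_)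
open import Data.Rational as ℚ using (ℚ; 1ℚ)
open import Data.Fin using (Fin; zero; suc; toℕ; fromℕ<)
open import Data.Fin.Subset using (Subset; _∈_)
open import Data.Product using (Σ; ∃; _×_)
open import Relation.Binary.PropositionalEquality using (_≡_)

-- Addition in ℤ_q, with ℤ_q represented by Fin q = {0,…,q-1}.
_⊕_ : ∀ {q} .{{_ : NonZero q}} → Fin q → Fin q → Fin q
_⊕_ {q} x y = fromℕ< (m%n<n (toℕ x ℕ.+ toℕ y) q)

-- Membership in the Minkowski sum A + B₀ + B₁ + ⋯ + B_{k-1} ⊆ ℤ_q.
InSumset : ∀ {q} .{{_ : NonZero q}} (k : ℕ) →
           Subset q → (Fin k → Subset q) → Fin q → Set
InSumset zero    A B z = z ∈ A
InSumset (suc k) A B z =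
  ∃ λ x → ∃ λ b → InSumset k A (λ i → B (suc i)) x × b ∈ B zero × z ≡ x ⊕ b

ℕtoℚ : ℕ → ℚ
ℕtoℚ n = + n ℚ./ 1

expTerm : ℚ → ℕ → ℚ
expTerm x zero    = 1ℚ
expTerm x (suc j) = expTerm x j ℚ.* (x ℚ.* (+ 1 ℚ./ suc j))

expPartial : ℚ → ℕ → ℚ
expPartial x zero    = ℚ.0ℚ
expPartial x (suc J) = expPartial x J ℚ.+ expTerm x J

-- For x ≥ 0:  "log q ≤ x", i.e. q ≤ e^x, witnessed by a partial sum of the
-- exponential series (exact, since e^x is irrational for rational x > 0 and
-- e^0 = 1 < q for q ≥ 2; partial sums increase to e^x).
LogLe : ℕ → ℚ → Set
LogLe q x = ∃ λ J → ℕtoℚ q ℚ.≤ expPartial x J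

{-# OPTIONS --safe #-}
module Submission where

-- Write u(Y) for the number of points of ℤ_q outside Y. Counting pairs (b, z) gives
-- Σ_b u(Y ∪ (X + b)) = u(Y) u(X), so some translate satisfies u(Y ∪ (X + b)) ≤ u(Y) u(X) / q.
-- Greedily adding m translates of X = A + B₁ + ⋯ + B_{i-1} to the empty set produces B_i with
-- u(X + B_i) ≤ q (u(X) / q)^m; after k rounds at most q (1 - t)^N points are missed, N = m^k.
-- This is < 1 because log q ≤ t N means q ≤ E_J(t N) for a partial sum E_J of the exponential
-- series, while E_J(a + b) ≤ E_J(a) E_J(b) (the binomial expansion of (a + b)^n / n! is part of
-- the Cauchy product) and (1 - t) E_J(t) < 1 give (1 - t)^N E_J(t N) < 1.

module Exponential where

  open import Level using (0ℓ)
  open import Function using (_∘_)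
  open import Data.Nat as ℕ using (ℕ; zero; suc)
  import Data.Nat.Properties as ℕ
  import Data.Integer as ℤ
  import Data.Integer.Properties as ℤ
  import Data.Nat.Coprimality as C
  open import Data.Rational as ℚ using (ℚ; 0ℚ; 1ℚ; _+_; _*_; _-_; _≤_; _<_)
  import Data.Rational.Properties as ℚ
  import Data.Rational.Unnormalised as ℚᵘ
  import Data.Rational.Unnormalised.Properties as ℚᵘ
  open import Data.Product using (_,_)
  open import Data.Empty using (⊥-elim)
  open import Relation.Binary.PropositionalEquality
  open import Relation.Nullary.Decidable using (dec⇒maybe)
  open import Algebra.Bundles using (CommutativeRing)
  open CommutativeRing ℚ.+-*-commutativeRing using (commutativeSemiring)
  open import Algebra.Properties.CommutativeSemiring.Exp commutativeSemiring using (_^_; ^-distrib-*)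
  open import Tactic.RingSolver using (solve-∀)
  open import Tactic.RingSolver.Core.AlmostCommutativeRing using (AlmostCommutativeRing; fromCommutativeRing)
  open import Defs

  ring : AlmostCommutativeRing 0ℓ 0ℓ
  ring = fromCommutativeRing ℚ.+-*-commutativeRing (λ x → dec⇒maybe (0ℚ ℚ.≟ x))

  ℕtoℚ-suc : ∀ n → ℕtoℚ (suc n) ≡ 1ℚ + ℕtoℚ n
  ℕtoℚ-suc n = ℚ.toℚᵘ-injective (begin-equality
    ℚ.toℚᵘ (ℕtoℚ (suc n))              ≃⟨ ℕtoℚᵘ (suc n) ⟩
    ℚᵘ.mkℚᵘ (ℤ.+ suc n) 0              ≃⟨ ℚᵘ.*≡* cross-mult ⟩
    ℚᵘ.1ℚᵘ ℚᵘ.+ ℚᵘ.mkℚᵘ (ℤ.+ n) 0      ≃⟨ ℚᵘ.+-congʳ ℚᵘ.1ℚᵘ (ℕtoℚᵘ n) ⟨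
    ℚ.toℚᵘ 1ℚ ℚᵘ.+ ℚ.toℚᵘ (ℕtoℚ n)     ≃⟨ ℚ.toℚᵘ-homo-+ 1ℚ (ℕtoℚ n) ⟨
    ℚ.toℚᵘ (1ℚ + ℕtoℚ n)               ∎)
    where
    open ℚᵘ.≤-Reasoning
    ℕtoℚᵘ : ∀ k → ℚ.toℚᵘ (ℕtoℚ k) ℚᵘ.≃ ℚᵘ.mkℚᵘ (ℤ.+ k) 0
    ℕtoℚᵘ k = ℚ.toℚᵘ-fromℚᵘ (ℚᵘ.mkℚᵘ (ℤ.+ k) 0)
    cross-mult : ℤ.+ suc n ℤ.* ℤ.+ 1 ≡ (ℤ.+ 1 ℤ.* ℤ.+ 1 ℤ.+ ℤ.+ n ℤ.* ℤ.+ 1) ℤ.* ℤ.+ 1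
    cross-mult = trans (ℤ.*-identityʳ (ℤ.+ suc n))
      (sym (trans (ℤ.*-identityʳ _) (cong (ℤ._+_ (ℤ.+ 1)) (ℤ.*-identityʳ (ℤ.+ n)))))

  [1+n]*x≡x+n*x : ∀ n x → ℕtoℚ (suc n) * x ≡ x + ℕtoℚ n * x
  [1+n]*x≡x+n*x n x = begin
    ℕtoℚ (suc n) * x        ≡⟨ cong (_* x) (ℕtoℚ-suc n) ⟩
    (1ℚ + ℕtoℚ n) * x       ≡⟨ ℚ.*-distribʳ-+ x 1ℚ (ℕtoℚ n) ⟩
    1ℚ * x + ℕtoℚ n * x     ≡⟨ cong (_+ ℕtoℚ n * x) (ℚ.*-identityˡ x) ⟩
    x + ℕtoℚ n * x          ∎
    where open ≡-Reasoning

  ℕtoℚ-+ : ∀ m n → ℕtoℚ (m ℕ.+ n) ≡ ℕtoℚ m + ℕtoℚ n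
  ℕtoℚ-+ zero    n = sym (ℚ.+-identityˡ (ℕtoℚ n))
  ℕtoℚ-+ (suc m) n = begin
    ℕtoℚ (suc (m ℕ.+ n))          ≡⟨ ℕtoℚ-suc (m ℕ.+ n) ⟩
    1ℚ + ℕtoℚ (m ℕ.+ n)           ≡⟨ cong (1ℚ +_) (ℕtoℚ-+ m n) ⟩
    1ℚ + (ℕtoℚ m + ℕtoℚ n)        ≡⟨ ℚ.+-assoc 1ℚ (ℕtoℚ m) (ℕtoℚ n) ⟨
    (1ℚ + ℕtoℚ m) + ℕtoℚ n        ≡⟨ cong (_+ ℕtoℚ n) (ℕtoℚ-suc m) ⟨
    ℕtoℚ (suc m) + ℕtoℚ n         ∎
    where open ≡-Reasoning

  ℕtoℚ-* : ∀ m n → ℕtoℚ (m ℕ.* n) ≡ ℕtoℚ m * ℕtoℚ n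
  ℕtoℚ-* zero    n = sym (ℚ.*-zeroˡ (ℕtoℚ n))
  ℕtoℚ-* (suc m) n = begin
    ℕtoℚ (n ℕ.+ m ℕ.* n)        ≡⟨ ℕtoℚ-+ n (m ℕ.* n) ⟩
    ℕtoℚ n + ℕtoℚ (m ℕ.* n)     ≡⟨ cong (ℕtoℚ n +_) (ℕtoℚ-* m n) ⟩
    ℕtoℚ n + ℕtoℚ m * ℕtoℚ n    ≡⟨ [1+n]*x≡x+n*x m (ℕtoℚ n) ⟨
    ℕtoℚ (suc m) * ℕtoℚ n       ∎
    where open ≡-Reasoning

  ℕtoℚ-^ : ∀ m n → ℕtoℚ (m ℕ.^ n) ≡ ℕtoℚ m ^ n
  ℕtoℚ-^ m zero    = refl
  ℕtoℚ-^ m (suc n) = trans (ℕtoℚ-* m (m ℕ.^ n)) (cong (ℕtoℚ m *_) (ℕtoℚ-^ m n))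

  ℕtoℚ-nonNeg : ∀ n → 0ℚ ≤ ℕtoℚ n
  ℕtoℚ-nonNeg n = ℚ.nonNegative⁻¹ (ℕtoℚ n) {{ℚ.normalize-nonNeg n 1}}

  ℕtoℚ-mono-≤ : ∀ {m n} → m ℕ.≤ n → ℕtoℚ m ≤ ℕtoℚ n
  ℕtoℚ-mono-≤ {m} {n} m≤n = begin
    ℕtoℚ m                      ≡⟨ ℚ.+-identityʳ (ℕtoℚ m) ⟨
    ℕtoℚ m + 0ℚ                 ≤⟨ ℚ.+-monoʳ-≤ (ℕtoℚ m) (ℕtoℚ-nonNeg (n ℕ.∸ m)) ⟩
    ℕtoℚ m + ℕtoℚ (n ℕ.∸ m)     ≡⟨ ℕtoℚ-+ m (n ℕ.∸ m) ⟨
    ℕtoℚ (m ℕ.+ (n ℕ.∸ m))      ≡⟨ cong ℕtoℚ (ℕ.m+[n∸m]≡n m≤n) ⟩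
    ℕtoℚ n                      ∎
    where open ℚ.≤-Reasoning

  ℕtoℚ-mono-< : ∀ {m n} → m ℕ.< n → ℕtoℚ m < ℕtoℚ n
  ℕtoℚ-mono-< {m} {n} m<n = begin-strict
    ℕtoℚ m           ≡⟨ ℚ.+-identityˡ (ℕtoℚ m) ⟨
    0ℚ + ℕtoℚ m      <⟨ ℚ.+-monoˡ-< (ℕtoℚ m) (ℚ.positive⁻¹ 1ℚ) ⟩
    1ℚ + ℕtoℚ m      ≡⟨ ℕtoℚ-suc m ⟨
    ℕtoℚ (suc m)     ≤⟨ ℕtoℚ-mono-≤ m<n ⟩
    ℕtoℚ n           ∎
    where open ℚ.≤-Reasoning

  ℕtoℚ-cancel-< : ∀ {m n} → ℕtoℚ m < ℕtoℚ n → m ℕ.< n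
  ℕtoℚ-cancel-< m<n = ℕ.≰⇒> (λ n≤m → ℚ.<-irrefl refl (ℚ.<-≤-trans m<n (ℕtoℚ-mono-≤ n≤m)))

  1/[1+n]*[1+n]≡1 : ∀ n → (ℤ.+ 1 ℚ./ suc n) * ℕtoℚ (suc n) ≡ 1ℚ
  1/[1+n]*[1+n]≡1 n = begin
    (ℤ.+ 1 ℚ./ suc n) * ℕtoℚ (suc n)
      ≡⟨ cong₂ _*_ (ℚ.normalize-coprime {1} {n} 1⊥1+n) (ℚ.normalize-coprime 1+n⊥1) ⟩
    ℚ.1/ [1+n] * [1+n]
      ≡⟨ ℚ.*-inverseˡ [1+n] ⟩
    1ℚ ∎
    where
    open ≡-Reasoning
    1⊥1+n : C.Coprime 1 (suc n)
    1⊥1+n = C.1-coprimeTo (suc n)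
    1+n⊥1 : C.Coprime (suc n) 1
    1+n⊥1 = C.sym 1⊥1+n
    [1+n] : ℚ
    [1+n] = ℚ.mkℚ (ℤ.+ suc n) 0 1+n⊥1

  1/[1+n]-pos : ∀ n → 0ℚ < ℤ.+ 1 ℚ./ suc n
  1/[1+n]-pos n = ℚ.positive⁻¹ _ {{ℚ.normalize-pos 1 (suc n)}}

  1/[1+n]≤1 : ∀ n → ℤ.+ 1 ℚ./ suc n ≤ 1ℚ
  1/[1+n]≤1 n = subst (_≤ 1ℚ) (sym (ℚ.normalize-coprime {1} {n} (C.1-coprimeTo (suc n))))
    (ℚ.*≤* (ℤ.+≤+ (ℕ.s≤s ℕ.z≤n)))

  *-nonNeg : ∀ {p q} → 0ℚ ≤ p → 0ℚ ≤ q → 0ℚ ≤ p * q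
  *-nonNeg {p} {q} 0≤p 0≤q =
    ℚ.nonNegative⁻¹ _ {{ℚ.nonNeg*nonNeg⇒nonNeg p {{ℚ.nonNegative 0≤p}} q {{ℚ.nonNegative 0≤q}}}}

  *-pos : ∀ {p q} → 0ℚ < p → 0ℚ < q → 0ℚ < p * q
  *-pos {p} {q} 0<p 0<q = ℚ.positive⁻¹ _ {{ℚ.pos*pos⇒pos p {{ℚ.positive 0<p}} q {{ℚ.positive 0<q}}}}

  *-monoˡ-≤ : ∀ {r p q} → 0ℚ ≤ r → p ≤ q → r * p ≤ r * q
  *-monoˡ-≤ {r} 0≤r = ℚ.*-monoˡ-≤-nonNeg r {{ℚ.nonNegative 0≤r}}

  *-monoʳ-≤ : ∀ {r p q} → 0ℚ ≤ r → p ≤ q → p * r ≤ q * r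
  *-monoʳ-≤ {r} 0≤r = ℚ.*-monoʳ-≤-nonNeg r {{ℚ.nonNegative 0≤r}}

  0≤q-p : ∀ {p q} → p ≤ q → 0ℚ ≤ q - p
  0≤q-p {p} {q} p≤q = begin
    0ℚ         ≡⟨ ℚ.+-inverseʳ p ⟨
    p - p      ≤⟨ ℚ.+-monoˡ-≤ (ℚ.- p) p≤q ⟩
    q - p      ∎
    where open ℚ.≤-Reasoning

  ^-nonNeg : ∀ {x} → 0ℚ ≤ x → ∀ n → 0ℚ ≤ x ^ n
  ^-nonNeg 0≤x zero    = ℚ.nonNegative⁻¹ 1ℚ
  ^-nonNeg 0≤x (suc n) = *-nonNeg 0≤x (^-nonNeg 0≤x n)

  ^-pos : ∀ {x} → 0ℚ < x → ∀ n → 0ℚ < x ^ n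
  ^-pos 0<x zero    = ℚ.positive⁻¹ 1ℚ
  ^-pos 0<x (suc n) = *-pos 0<x (^-pos 0<x n)

  ^-monoˡ-≤ : ∀ {x y} → 0ℚ ≤ x → x ≤ y → ∀ n → x ^ n ≤ y ^ n
  ^-monoˡ-≤ 0≤x x≤y zero    = ℚ.≤-refl
  ^-monoˡ-≤ {x} {y} 0≤x x≤y (suc n) = begin
    x * x ^ n   ≤⟨ *-monoʳ-≤ (^-nonNeg 0≤x n) x≤y ⟩
    y * x ^ n   ≤⟨ *-monoˡ-≤ (ℚ.≤-trans 0≤x x≤y) (^-monoˡ-≤ 0≤x x≤y n) ⟩
    y * y ^ n   ∎
    where open ℚ.≤-Reasoning

  ^-≤1 : ∀ {x} → 0ℚ ≤ x → x ≤ 1ℚ → ∀ n → x ^ n ≤ 1ℚ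
  ^-≤1 0≤x x≤1 zero    = ℚ.≤-refl
  ^-≤1 {x} 0≤x x≤1 (suc n) = begin
    x * x ^ n   ≤⟨ *-monoˡ-≤ 0≤x (^-≤1 0≤x x≤1 n) ⟩
    x * 1ℚ      ≡⟨ ℚ.*-identityʳ x ⟩
    x           ≤⟨ x≤1 ⟩
    1ℚ          ∎
    where open ℚ.≤-Reasoning

  ^-<1 : ∀ {x} → 0ℚ ≤ x → x < 1ℚ → ∀ n → x ^ suc n < 1ℚ
  ^-<1 {x} 0≤x x<1 n = begin-strict
    x * x ^ n  ≤⟨ *-monoˡ-≤ 0≤x (^-≤1 0≤x (ℚ.<⇒≤ x<1) n) ⟩
    x * 1ℚ     ≡⟨ ℚ.*-identityʳ x ⟩
    x          <⟨ x<1 ⟩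
    1ℚ         ∎
    where open ℚ.≤-Reasoning

  ∂ : (ℕ → ℚ) → ℕ → ℚ
  ∂ f n = ℕtoℚ (suc n) * f (suc n)

  -- (f ⋆ g) n = Σ_{i+j=n} f i * g j
  infixl 7 _⋆_
  _⋆_ : (ℕ → ℚ) → (ℕ → ℚ) → ℕ → ℚ
  (f ⋆ g) zero    = f 0 * g 0
  (f ⋆ g) (suc n) = f 0 * g (suc n) + (f ∘ suc ⋆ g) n

  ⋆-cong : ∀ {f f′ g g′} → f ≗ f′ → g ≗ g′ → f ⋆ g ≗ f′ ⋆ g′
  ⋆-cong f≗f′ g≗g′ zero    = cong₂ _*_ (f≗f′ 0) (g≗g′ 0)
  ⋆-cong f≗f′ g≗g′ (suc n) =
    cong₂ _+_ (cong₂ _*_ (f≗f′ 0) (g≗g′ (suc n))) (⋆-cong (f≗f′ ∘ suc) g≗g′ n)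

  ⋆-distribʳ-+ : ∀ f h g n → ((λ i → f i + h i) ⋆ g) n ≡ (f ⋆ g) n + (h ⋆ g) n
  ⋆-distribʳ-+ f h g zero    = ℚ.*-distribʳ-+ (g 0) (f 0) (h 0)
  ⋆-distribʳ-+ f h g (suc n) = begin
    (f 0 + h 0) * g (suc n) + ((λ i → f (suc i) + h (suc i)) ⋆ g) n
      ≡⟨ cong ((f 0 + h 0) * g (suc n) +_) (⋆-distribʳ-+ (f ∘ suc) (h ∘ suc) g n) ⟩
    (f 0 + h 0) * g (suc n) + ((f ∘ suc ⋆ g) n + (h ∘ suc ⋆ g) n)
      ≡⟨ regroup (f 0) (h 0) (g (suc n)) _ _ ⟩
    (f 0 * g (suc n) + (f ∘ suc ⋆ g) n) + (h 0 * g (suc n) + (h ∘ suc ⋆ g) n) ∎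
    where
    open ≡-Reasoning
    regroup : ∀ a b c u v → (a + b) * c + (u + v) ≡ (a * c + u) + (b * c + v)
    regroup = solve-∀ ring

  ⋆-scaleˡ : ∀ c f g n → ((λ i → c * f i) ⋆ g) n ≡ c * (f ⋆ g) n
  ⋆-scaleˡ c f g zero    = ℚ.*-assoc c (f 0) (g 0)
  ⋆-scaleˡ c f g (suc n) = begin
    c * f 0 * g (suc n) + ((λ i → c * f (suc i)) ⋆ g) n
      ≡⟨ cong (c * f 0 * g (suc n) +_) (⋆-scaleˡ c (f ∘ suc) g n) ⟩
    c * f 0 * g (suc n) + c * (f ∘ suc ⋆ g) n
      ≡⟨ regroup c (f 0) (g (suc n)) _ ⟩
    c * (f 0 * g (suc n) + (f ∘ suc ⋆ g) n) ∎
    where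
    open ≡-Reasoning
    regroup : ∀ c a b u → c * a * b + c * u ≡ c * (a * b + u)
    regroup = solve-∀ ring

  ⋆-scaleʳ : ∀ c f g n → (f ⋆ (λ j → c * g j)) n ≡ c * (f ⋆ g) n
  ⋆-scaleʳ c f g zero    = trans (sym (ℚ.*-assoc (f 0) c (g 0)))
    (trans (cong (_* g 0) (ℚ.*-comm (f 0) c)) (ℚ.*-assoc c (f 0) (g 0)))
  ⋆-scaleʳ c f g (suc n) = begin
    f 0 * (c * g (suc n)) + (f ∘ suc ⋆ (λ j → c * g j)) n
      ≡⟨ cong (f 0 * (c * g (suc n)) +_) (⋆-scaleʳ c (f ∘ suc) g n) ⟩
    f 0 * (c * g (suc n)) + c * (f ∘ suc ⋆ g) n
      ≡⟨ regroup c (f 0) (g (suc n)) _ ⟩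
    c * (f 0 * g (suc n) + (f ∘ suc ⋆ g) n) ∎
    where
    open ≡-Reasoning
    regroup : ∀ c a b u → a * (c * b) + c * u ≡ c * (a * b + u)
    regroup = solve-∀ ring

  ∂-suc : ∀ f n → ∂ f (suc n) ≡ f (suc (suc n)) + ∂ (f ∘ suc) n
  ∂-suc f n = [1+n]*x≡x+n*x (suc n) (f (suc (suc n)))

  ∂-⋆ : ∀ f g n → ∂ (f ⋆ g) n ≡ (∂ f ⋆ g) n + (f ⋆ ∂ g) n
  ∂-⋆ f g zero    = regroup (f 0) (f 1) (g 0) (g 1)
    where
    regroup : ∀ a₀ a₁ b₀ b₁ → 1ℚ * (a₀ * b₁ + a₁ * b₀) ≡ 1ℚ * a₁ * b₀ + a₀ * (1ℚ * b₁)
    regroup = solve-∀ ring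
  ∂-⋆ f g (suc n) = begin
    N₂ * (f 0 * g (suc (suc n)) + S)
      ≡⟨ pull N₂ (f 0) (g (suc (suc n))) S ⟩
    f 0 * ∂ g (suc n) + N₂ * S
      ≡⟨ cong (f 0 * ∂ g (suc n) +_) ([1+n]*x≡x+n*x (suc n) S) ⟩
    f 0 * ∂ g (suc n) + (S + ∂ (f ∘ suc ⋆ g) n)
      ≡⟨ cong (λ u → f 0 * ∂ g (suc n) + (S + u)) (∂-⋆ (f ∘ suc) g n) ⟩
    f 0 * ∂ g (suc n) + (S + (P + Q))
      ≡⟨ regroup (f 0 * ∂ g (suc n)) (f 1) (g (suc n)) F P Q ⟩
    1ℚ * f 1 * g (suc n) + (F + P) + (f 0 * ∂ g (suc n) + Q)
      ≡⟨ cong (λ u → 1ℚ * f 1 * g (suc n) + u + (f 0 * ∂ g (suc n) + Q)) ∂f∘suc⋆g ⟨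
    (∂ f ⋆ g) (suc n) + (f ⋆ ∂ g) (suc n) ∎
    where
    open ≡-Reasoning
    N₂ S F P Q : ℚ
    N₂ = ℕtoℚ (suc (suc n))
    S = (f ∘ suc ⋆ g) (suc n)
    F = (f ∘ suc ∘ suc ⋆ g) n
    P = (∂ (f ∘ suc) ⋆ g) n
    Q = (f ∘ suc ⋆ ∂ g) n
    ∂f∘suc⋆g : (∂ f ∘ suc ⋆ g) n ≡ F + P
    ∂f∘suc⋆g = trans (⋆-cong (∂-suc f) (λ _ → refl) n)
                     (⋆-distribʳ-+ (f ∘ suc ∘ suc) (∂ (f ∘ suc)) g n)
    pull : ∀ N a b s → N * (a * b + s) ≡ a * (N * b) + N * s
    pull = solve-∀ ring
    regroup : ∀ a x y u v w → a + ((x * y + u) + (v + w)) ≡ 1ℚ * x * y + (u + v) + (a + w)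
    regroup = solve-∀ ring

  ∂-expTerm : ∀ x n → ∂ (expTerm x) n ≡ x * expTerm x n
  ∂-expTerm x n = begin
    N * (expTerm x n * (x * r))  ≡⟨ regroup N (expTerm x n) x r ⟩
    x * expTerm x n * (r * N)    ≡⟨ cong (x * expTerm x n *_) (1/[1+n]*[1+n]≡1 n) ⟩
    x * expTerm x n * 1ℚ         ≡⟨ ℚ.*-identityʳ (x * expTerm x n) ⟩
    x * expTerm x n              ∎
    where
    open ≡-Reasoning
    N r : ℚ
    N = ℕtoℚ (suc n)
    r = ℤ.+ 1 ℚ./ suc n
    regroup : ∀ N t x r → N * (t * (x * r)) ≡ x * t * (r * N)
    regroup = solve-∀ ring

  expTerm-unique : ∀ x f → f 0 ≡ 1ℚ → (∀ n → ∂ f n ≡ x * f n) → f ≗ expTerm x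
  expTerm-unique x f f0≡1 ∂f≡xf zero    = f0≡1
  expTerm-unique x f f0≡1 ∂f≡xf (suc n) = begin
    f (suc n)                  ≡⟨ ℚ.*-identityˡ (f (suc n)) ⟨
    1ℚ * f (suc n)             ≡⟨ cong (_* f (suc n)) (1/[1+n]*[1+n]≡1 n) ⟨
    r * N * f (suc n)          ≡⟨ ℚ.*-assoc r N (f (suc n)) ⟩
    r * ∂ f n                  ≡⟨ cong (r *_) (∂f≡xf n) ⟩
    r * (x * f n)              ≡⟨ cong (λ y → r * (x * y)) (expTerm-unique x f f0≡1 ∂f≡xf n) ⟩
    r * (x * expTerm x n)      ≡⟨ regroup r x (expTerm x n) ⟩
    expTerm x n * (x * r)      ∎
    where
    open ≡-Reasoning
    N r : ℚ
    N = ℕtoℚ (suc n)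
    r = ℤ.+ 1 ℚ./ suc n
    regroup : ∀ r x t → r * (x * t) ≡ t * (x * r)
    regroup = solve-∀ ring

  expTerm-⋆ : ∀ a b → expTerm a ⋆ expTerm b ≗ expTerm (a + b)
  expTerm-⋆ a b = expTerm-unique (a + b) (expTerm a ⋆ expTerm b) refl ∂-eq
    where
    open ≡-Reasoning
    ∂-eq : ∀ n → ∂ (expTerm a ⋆ expTerm b) n ≡ (a + b) * (expTerm a ⋆ expTerm b) n
    ∂-eq n = begin
      ∂ (expTerm a ⋆ expTerm b) n
        ≡⟨ ∂-⋆ (expTerm a) (expTerm b) n ⟩
      (∂ (expTerm a) ⋆ expTerm b) n + (expTerm a ⋆ ∂ (expTerm b)) n
        ≡⟨ cong₂ _+_ (⋆-cong (∂-expTerm a) (λ _ → refl) n) (⋆-cong (λ _ → refl) (∂-expTerm b) n) ⟩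
      ((λ i → a * expTerm a i) ⋆ expTerm b) n + (expTerm a ⋆ (λ j → b * expTerm b j)) n
        ≡⟨ cong₂ _+_ (⋆-scaleˡ a (expTerm a) (expTerm b) n) (⋆-scaleʳ b (expTerm a) (expTerm b) n) ⟩
      a * (expTerm a ⋆ expTerm b) n + b * (expTerm a ⋆ expTerm b) n
        ≡⟨ ℚ.*-distribʳ-+ _ a b ⟨
      (a + b) * (expTerm a ⋆ expTerm b) n ∎

  partialSum : (ℕ → ℚ) → ℕ → ℚ
  partialSum f zero    = 0ℚ
  partialSum f (suc J) = partialSum f J + f J

  partialSum-cong : ∀ {f g} → f ≗ g → partialSum f ≗ partialSum g
  partialSum-cong f≗g zero    = refl
  partialSum-cong f≗g (suc J) = cong₂ _+_ (partialSum-cong f≗g J) (f≗g J)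

  expPartial≡partialSum : ∀ x → expPartial x ≗ partialSum (expTerm x)
  expPartial≡partialSum x zero    = refl
  expPartial≡partialSum x (suc J) = cong (_+ expTerm x J) (expPartial≡partialSum x J)

  partialSum-nonNeg : ∀ {f} → (∀ j → 0ℚ ≤ f j) → ∀ J → 0ℚ ≤ partialSum f J
  partialSum-nonNeg f≥0 zero    = ℚ.≤-refl
  partialSum-nonNeg f≥0 (suc J) = ℚ.+-mono-≤ (partialSum-nonNeg f≥0 J) (f≥0 J)

  partialSum-≤-suc : ∀ {f} → (∀ j → 0ℚ ≤ f j) → ∀ J → partialSum f J ≤ partialSum f (suc J)
  partialSum-≤-suc {f} f≥0 J = begin
    partialSum f J         ≡⟨ ℚ.+-identityʳ (partialSum f J) ⟨
    partialSum f J + 0ℚ    ≤⟨ ℚ.+-monoʳ-≤ (partialSum f J) (f≥0 J) ⟩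
    partialSum f (suc J)   ∎
    where open ℚ.≤-Reasoning

  partialSum-suc : ∀ f J → partialSum f (suc J) ≡ f 0 + partialSum (f ∘ suc) J
  partialSum-suc f zero    = trans (ℚ.+-identityˡ (f 0)) (sym (ℚ.+-identityʳ (f 0)))
  partialSum-suc f (suc J) = begin
    partialSum f (suc J) + f (suc J)             ≡⟨ cong (_+ f (suc J)) (partialSum-suc f J) ⟩
    f 0 + partialSum (f ∘ suc) J + f (suc J)     ≡⟨ ℚ.+-assoc (f 0) _ (f (suc J)) ⟩
    f 0 + partialSum (f ∘ suc) (suc J)           ∎
    where open ≡-Reasoning

  partialSum-⋆ : ∀ f g J →
                 partialSum (f ⋆ g) (suc J) ≡ f 0 * partialSum g (suc J) + partialSum (f ∘ suc ⋆ g) J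
  partialSum-⋆ f g zero    = regroup (f 0) (g 0)
    where
    regroup : ∀ a b → 0ℚ + a * b ≡ a * (0ℚ + b) + 0ℚ
    regroup = solve-∀ ring
  partialSum-⋆ f g (suc J) = begin
    partialSum (f ⋆ g) (suc J) + (f 0 * g (suc J) + (f ∘ suc ⋆ g) J)
      ≡⟨ cong (_+ (f 0 * g (suc J) + (f ∘ suc ⋆ g) J)) (partialSum-⋆ f g J) ⟩
    f 0 * partialSum g (suc J) + partialSum (f ∘ suc ⋆ g) J + (f 0 * g (suc J) + (f ∘ suc ⋆ g) J)
      ≡⟨ regroup (f 0) (partialSum g (suc J)) (g (suc J)) _ _ ⟩
    f 0 * (partialSum g (suc J) + g (suc J)) + (partialSum (f ∘ suc ⋆ g) J + (f ∘ suc ⋆ g) J) ∎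
    where
    open ≡-Reasoning
    regroup : ∀ a s b u v → a * s + u + (a * b + v) ≡ a * (s + b) + (u + v)
    regroup = solve-∀ ring

  partialSum-⋆-≤ : ∀ {f g} → (∀ i → 0ℚ ≤ f i) → (∀ j → 0ℚ ≤ g j) →
                   ∀ J → partialSum (f ⋆ g) J ≤ partialSum f J * partialSum g J
  partialSum-⋆-≤ f≥0 g≥0 zero = ℚ.≤-refl
  partialSum-⋆-≤ {f} {g} f≥0 g≥0 (suc J) = begin
    partialSum (f ⋆ g) (suc J)
      ≡⟨ partialSum-⋆ f g J ⟩
    f 0 * G + partialSum (f ∘ suc ⋆ g) J
      ≤⟨ ℚ.+-monoʳ-≤ (f 0 * G) (partialSum-⋆-≤ (f≥0 ∘ suc) g≥0 J) ⟩
    f 0 * G + partialSum (f ∘ suc) J * partialSum g J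
      ≤⟨ ℚ.+-monoʳ-≤ (f 0 * G) (*-monoˡ-≤ (partialSum-nonNeg (f≥0 ∘ suc) J) (partialSum-≤-suc g≥0 J)) ⟩
    f 0 * G + partialSum (f ∘ suc) J * G
      ≡⟨ ℚ.*-distribʳ-+ G (f 0) _ ⟨
    (f 0 + partialSum (f ∘ suc) J) * G
      ≡⟨ cong (_* G) (partialSum-suc f J) ⟨
    partialSum f (suc J) * G ∎
    where
    open ℚ.≤-Reasoning
    G : ℚ
    G = partialSum g (suc J)

  expTerm-nonNeg : ∀ {x} → 0ℚ ≤ x → ∀ j → 0ℚ ≤ expTerm x j
  expTerm-nonNeg 0≤x zero    = ℚ.nonNegative⁻¹ 1ℚ
  expTerm-nonNeg 0≤x (suc j) =
    *-nonNeg (expTerm-nonNeg 0≤x j) (*-nonNeg 0≤x (ℚ.<⇒≤ (1/[1+n]-pos j)))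

  expTerm-pos : ∀ {x} → 0ℚ < x → ∀ j → 0ℚ < expTerm x j
  expTerm-pos 0<x zero    = ℚ.positive⁻¹ 1ℚ
  expTerm-pos 0<x (suc j) = *-pos (expTerm-pos 0<x j) (*-pos 0<x (1/[1+n]-pos j))

  expTerm-suc-≤ : ∀ {x} → 0ℚ ≤ x → ∀ j → expTerm x (suc j) ≤ x * expTerm x j
  expTerm-suc-≤ {x} 0≤x j = begin
    expTerm x j * (x * (ℤ.+ 1 ℚ./ suc j))
      ≤⟨ *-monoˡ-≤ (expTerm-nonNeg 0≤x j) (*-monoˡ-≤ 0≤x (1/[1+n]≤1 j)) ⟩
    expTerm x j * (x * 1ℚ)
      ≡⟨ cong (expTerm x j *_) (ℚ.*-identityʳ x) ⟩
    expTerm x j * x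
      ≡⟨ ℚ.*-comm (expTerm x j) x ⟩
    x * expTerm x j ∎
    where open ℚ.≤-Reasoning

  expPartial-nonNeg : ∀ {x} → 0ℚ ≤ x → ∀ J → 0ℚ ≤ expPartial x J
  expPartial-nonNeg {x} 0≤x J =
    subst (0ℚ ≤_) (sym (expPartial≡partialSum x J)) (partialSum-nonNeg (expTerm-nonNeg 0≤x) J)

  expPartial-+-≤ : ∀ {a b} → 0ℚ ≤ a → 0ℚ ≤ b → ∀ J →
                   expPartial (a + b) J ≤ expPartial a J * expPartial b J
  expPartial-+-≤ {a} {b} 0≤a 0≤b J = begin
    expPartial (a + b) J
      ≡⟨ expPartial≡partialSum (a + b) J ⟩
    partialSum (expTerm (a + b)) J
      ≡⟨ partialSum-cong (expTerm-⋆ a b) J ⟨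
    partialSum (expTerm a ⋆ expTerm b) J
      ≤⟨ partialSum-⋆-≤ (expTerm-nonNeg 0≤a) (expTerm-nonNeg 0≤b) J ⟩
    partialSum (expTerm a) J * partialSum (expTerm b) J
      ≡⟨ cong₂ _*_ (expPartial≡partialSum a J) (expPartial≡partialSum b J) ⟨
    expPartial a J * expPartial b J ∎
    where open ℚ.≤-Reasoning

  expPartial-*ℕ-≤ : ∀ {t} → 0ℚ ≤ t → ∀ N J →
                    expPartial (t * ℕtoℚ (suc N)) J ≤ expPartial t J ^ suc N
  expPartial-*ℕ-≤ {t} 0≤t zero J = begin
    expPartial (t * 1ℚ) J      ≡⟨ cong (λ x → expPartial x J) (ℚ.*-identityʳ t) ⟩
    expPartial t J             ≡⟨ ℚ.*-identityʳ (expPartial t J) ⟨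
    expPartial t J * 1ℚ        ∎
    where open ℚ.≤-Reasoning
  expPartial-*ℕ-≤ {t} 0≤t (suc N) J = begin
    expPartial (t * ℕtoℚ (suc (suc N))) J
      ≡⟨ cong (λ x → expPartial x J) t[1+N]≡t+tN ⟩
    expPartial (t + t * ℕtoℚ (suc N)) J
      ≤⟨ expPartial-+-≤ 0≤t (*-nonNeg 0≤t (ℕtoℚ-nonNeg (suc N))) J ⟩
    expPartial t J * expPartial (t * ℕtoℚ (suc N)) J
      ≤⟨ *-monoˡ-≤ (expPartial-nonNeg 0≤t J) (expPartial-*ℕ-≤ 0≤t N J) ⟩
    expPartial t J * expPartial t J ^ suc N ∎
    where
    open ℚ.≤-Reasoning
    t[1+N]≡t+tN : t * ℕtoℚ (suc (suc N)) ≡ t + t * ℕtoℚ (suc N)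
    t[1+N]≡t+tN = trans (cong (t *_) (ℕtoℚ-suc (suc N)))
      (trans (ℚ.*-distribˡ-+ t 1ℚ _) (cong (_+ t * ℕtoℚ (suc N)) (ℚ.*-identityʳ t)))

  [1-x]*expPartial+expTerm≤1 : ∀ {x} → 0ℚ ≤ x → ∀ J →
                               (1ℚ - x) * expPartial x J + expTerm x J ≤ 1ℚ
  [1-x]*expPartial+expTerm≤1 {x} 0≤x zero    = ℚ.≤-reflexive (base x)
    where
    base : ∀ x → (1ℚ - x) * 0ℚ + 1ℚ ≡ 1ℚ
    base = solve-∀ ring
  [1-x]*expPartial+expTerm≤1 {x} 0≤x (suc J) = begin
    (1ℚ - x) * (E + T) + expTerm x (suc J)   ≤⟨ ℚ.+-monoʳ-≤ ((1ℚ - x) * (E + T)) (expTerm-suc-≤ 0≤x J) ⟩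
    (1ℚ - x) * (E + T) + x * T               ≡⟨ telescope x E T ⟩
    (1ℚ - x) * E + T                         ≤⟨ [1-x]*expPartial+expTerm≤1 0≤x J ⟩
    1ℚ                                       ∎
    where
    open ℚ.≤-Reasoning
    E T : ℚ
    E = expPartial x J
    T = expTerm x J
    telescope : ∀ x e t → (1ℚ - x) * (e + t) + x * t ≡ (1ℚ - x) * e + t
    telescope = solve-∀ ring

  [1-t]*expPartial<1 : ∀ {t} → 0ℚ < t → ∀ J → (1ℚ - t) * expPartial t J < 1ℚ
  [1-t]*expPartial<1 {t} 0<t J = begin-strict
    (1ℚ - t) * expPartial t J
      ≡⟨ ℚ.+-identityʳ _ ⟨
    (1ℚ - t) * expPartial t J + 0ℚ
      <⟨ ℚ.+-monoʳ-< ((1ℚ - t) * expPartial t J) (expTerm-pos 0<t J) ⟩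
    (1ℚ - t) * expPartial t J + expTerm t J
      ≤⟨ [1-x]*expPartial+expTerm≤1 (ℚ.<⇒≤ 0<t) J ⟩
    1ℚ ∎
    where open ℚ.≤-Reasoning

  expPartial0≤1 : ∀ J → expPartial 0ℚ J ≤ 1ℚ
  expPartial0≤1 J = begin
    expPartial 0ℚ J
      ≡⟨ ℚ.*-identityˡ (expPartial 0ℚ J) ⟨
    (1ℚ - 0ℚ) * expPartial 0ℚ J
      ≡⟨ ℚ.+-identityʳ _ ⟨
    (1ℚ - 0ℚ) * expPartial 0ℚ J + 0ℚ
      ≤⟨ ℚ.+-monoʳ-≤ ((1ℚ - 0ℚ) * expPartial 0ℚ J) (expTerm-nonNeg ℚ.≤-refl J) ⟩
    (1ℚ - 0ℚ) * expPartial 0ℚ J + expTerm 0ℚ J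
      ≤⟨ [1-x]*expPartial+expTerm≤1 ℚ.≤-refl J ⟩
    1ℚ ∎
    where open ℚ.≤-Reasoning

  [1-t]^N*expPartial[tN]<1 : ∀ {t} → 0ℚ < t → t < 1ℚ → ∀ N J →
                             (1ℚ - t) ^ suc N * expPartial (t * ℕtoℚ (suc N)) J < 1ℚ
  [1-t]^N*expPartial[tN]<1 {t} 0<t t<1 N J = begin-strict
    (1ℚ - t) ^ suc N * expPartial (t * ℕtoℚ (suc N)) J
      ≤⟨ *-monoˡ-≤ (^-nonNeg 0≤1-t (suc N)) (expPartial-*ℕ-≤ (ℚ.<⇒≤ 0<t) N J) ⟩
    (1ℚ - t) ^ suc N * expPartial t J ^ suc N
      ≡⟨ ^-distrib-* (1ℚ - t) (expPartial t J) (suc N) ⟨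
    ((1ℚ - t) * expPartial t J) ^ suc N
      <⟨ ^-<1 (*-nonNeg 0≤1-t (expPartial-nonNeg (ℚ.<⇒≤ 0<t) J)) ([1-t]*expPartial<1 0<t J) N ⟩
    1ℚ ∎
    where
    open ℚ.≤-Reasoning
    0≤1-t : 0ℚ ≤ 1ℚ - t
    0≤1-t = 0≤q-p (ℚ.<⇒≤ t<1)

  q*[1-t]^N<1 : ∀ {q t} N → 2 ℕ.≤ q → 0ℚ < t → t < 1ℚ → LogLe q (t * ℕtoℚ N) →
                ℕtoℚ q * (1ℚ - t) ^ N < 1ℚ
  q*[1-t]^N<1 {q} {t} zero 2≤q 0<t t<1 (J , q≤e^0) = ⊥-elim (ℚ.<-irrefl refl (begin-strict
    1ℚ                        <⟨ ℕtoℚ-mono-< 2≤q ⟩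
    ℕtoℚ q                    ≤⟨ q≤e^0 ⟩
    expPartial (t * 0ℚ) J     ≡⟨ cong (λ x → expPartial x J) (ℚ.*-zeroʳ t) ⟩
    expPartial 0ℚ J           ≤⟨ expPartial0≤1 J ⟩
    1ℚ                        ∎))
    where open ℚ.≤-Reasoning
  q*[1-t]^N<1 {q} {t} (suc N) 2≤q 0<t t<1 (J , q≤e^tN) = begin-strict
    ℕtoℚ q * (1ℚ - t) ^ suc N
      ≤⟨ *-monoʳ-≤ (^-nonNeg (0≤q-p (ℚ.<⇒≤ t<1)) (suc N)) q≤e^tN ⟩
    expPartial (t * ℕtoℚ (suc N)) J * (1ℚ - t) ^ suc N
      ≡⟨ ℚ.*-comm (expPartial (t * ℕtoℚ (suc N)) J) ((1ℚ - t) ^ suc N) ⟩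
    (1ℚ - t) ^ suc N * expPartial (t * ℕtoℚ (suc N)) J
      <⟨ [1-t]^N*expPartial[tN]<1 0<t t<1 N J ⟩
    1ℚ ∎
    where open ℚ.≤-Reasoning

  c≤[1-t]q : ∀ {q a c t} → c ℕ.+ a ≡ q → t * ℕtoℚ q ≤ ℕtoℚ a → ℕtoℚ c ≤ (1ℚ - t) * ℕtoℚ q
  c≤[1-t]q {q} {a} {c} {t} c+a≡q tq≤a = begin
    C                   ≡⟨ cancel C (t * Q) ⟩
    C + t * Q - t * Q   ≤⟨ ℚ.+-monoˡ-≤ (ℚ.- (t * Q)) (ℚ.+-monoʳ-≤ C tq≤a) ⟩
    C + A - t * Q       ≡⟨ cong (λ x → x - t * Q) Q≡C+A ⟨
    Q - t * Q           ≡⟨ factor Q t ⟩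
    (1ℚ - t) * Q        ∎
    where
    open ℚ.≤-Reasoning
    Q C A : ℚ
    Q = ℕtoℚ q
    C = ℕtoℚ c
    A = ℕtoℚ a
    Q≡C+A : Q ≡ C + A
    Q≡C+A = trans (cong ℕtoℚ (sym c+a≡q)) (ℕtoℚ-+ c a)
    cancel : ∀ c u → c ≡ c + u - u
    cancel = solve-∀ ring
    factor : ∀ q t → q - t * q ≡ (1ℚ - t) * q
    factor = solve-∀ ring

  q*c^N<q^N : ∀ {q a c t} N → 2 ℕ.≤ q → c ℕ.+ a ≡ q → 0ℚ < t → t < 1ℚ → t * ℕtoℚ q ≤ ℕtoℚ a →
              LogLe q (t * ℕtoℚ N) → q ℕ.* c ℕ.^ N ℕ.< q ℕ.^ N
  q*c^N<q^N {q} {a} {c} {t} N 2≤q c+a≡q 0<t t<1 tq≤a logq≤tN = ℕtoℚ-cancel-< (begin-strict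
    ℕtoℚ (q ℕ.* c ℕ.^ N)
      ≡⟨ trans (ℕtoℚ-* q (c ℕ.^ N)) (cong (Q *_) (ℕtoℚ-^ c N)) ⟩
    Q * C ^ N
      ≤⟨ *-monoˡ-≤ (ℕtoℚ-nonNeg q) (^-monoˡ-≤ (ℕtoℚ-nonNeg c) (c≤[1-t]q {a = a} {t = t} c+a≡q tq≤a) N) ⟩
    Q * ((1ℚ - t) * Q) ^ N
      ≡⟨ cong (Q *_) (^-distrib-* (1ℚ - t) Q N) ⟩
    Q * ((1ℚ - t) ^ N * Q ^ N)
      ≡⟨ ℚ.*-assoc Q _ _ ⟨
    Q * (1ℚ - t) ^ N * Q ^ N
      <⟨ ℚ.*-monoˡ-<-pos (Q ^ N) {{ℚ.positive (^-pos Q>0 N)}} (q*[1-t]^N<1 N 2≤q 0<t t<1 logq≤tN) ⟩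
    1ℚ * Q ^ N
      ≡⟨ ℚ.*-identityˡ (Q ^ N) ⟩
    Q ^ N
      ≡⟨ ℕtoℚ-^ q N ⟨
    ℕtoℚ (q ℕ.^ N) ∎)
    where
    open ℚ.≤-Reasoning
    Q C : ℚ
    Q = ℕtoℚ q
    C = ℕtoℚ c
    Q>0 : 0ℚ < Q
    Q>0 = ℕtoℚ-mono-< (ℕ.<-trans (ℕ.s≤s ℕ.z≤n) 2≤q)



module Covering where

  open import Function using (_∘_)
  open import Data.Bool using (Bool; true; false; not; _∨_)
  open import Data.Nat as ℕ using (ℕ; zero; suc; NonZero; _+_; _*_; _^_; _∸_; _%_; _≤_; _<_; z≤n; s≤s)
  import Data.Nat.Properties as ℕ
  open import Data.Nat.DivMod using (m%n<n; %-distribˡ-+; m%n%n≡m%n; [m+n]%n≡m%n; m<n⇒m%n≡m)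
  open import Data.Fin as Fin using (Fin; toℕ; fromℕ<)
  import Data.Fin.Properties as Fin
  open import Data.Fin.Subset using (Subset; _∈_; _∪_; ⁅_⁆; ∣_∣; inside; outside; ⊥)
  open import Data.Fin.Subset.Properties using (∣⊥∣≡0; ∣⁅x⁆∣≡1; x∈⁅x⁆; x∈p∪q⁺)
  open import Data.Fin.Permutation using (permutation)
  open import Data.Vec using (_∷_; []; lookup)
  open import Data.Vec.Properties using (lookup⇒[]=)
  import Data.Vec.Functional as Vector
  open import Data.Product using (_,_; ∃; _×_; proj₁; proj₂)
  open import Data.Sum using (inj₁; inj₂)
  open import Relation.Binary.PropositionalEquality
  open import Relation.Nullary using (yes; no; contradiction)
  open import Algebra.Properties.CommutativeMonoid.Sum ℕ.+-0-commutativeMonoid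
    using (sum; ∑-comm; ∑-permute; sum-cong-≗)
  open import Algebra.Properties.Semiring.Sum ℕ.+-*-semiring using (*-distribˡ-sum; *-distribʳ-sum)
  open import Algebra.Properties.CommutativeSemigroup ℕ.*-commutativeSemigroup
    using (x∙yz≈y∙xz; xy∙z≈x∙zy; xy∙z≈y∙xz)
  open import Defs

  𝟙 : Bool → ℕ
  𝟙 true  = 1
  𝟙 false = 0

  𝟙-not-∨ : ∀ x y → 𝟙 (not (x ∨ y)) ≡ 𝟙 (not x) * 𝟙 (not y)
  𝟙-not-∨ true  y     = refl
  𝟙-not-∨ false true  = refl
  𝟙-not-∨ false false = refl

  𝟙-not≡0 : ∀ x → 𝟙 (not x) ≡ 0 → x ≡ true
  𝟙-not≡0 true _ = refl

  𝟙≤1 : ∀ x → 𝟙 x ≤ 1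
  𝟙≤1 true  = s≤s z≤n
  𝟙≤1 false = z≤n

  uncovered : ∀ {n} → (Fin n → Bool) → ℕ
  uncovered X = sum (λ z → 𝟙 (not (X z)))

  uncovered≤n : ∀ {n} (X : Fin n → Bool) → uncovered X ≤ n
  uncovered≤n {zero}  X = z≤n
  uncovered≤n {suc n} X = ℕ.+-mono-≤ (𝟙≤1 (not (X Fin.zero))) (uncovered≤n (X ∘ Fin.suc))

  uncovered≡0⇒≡true : ∀ {n} (X : Fin n → Bool) → uncovered X ≡ 0 → ∀ z → X z ≡ true
  uncovered≡0⇒≡true X eq Fin.zero    = 𝟙-not≡0 (X Fin.zero) (ℕ.m+n≡0⇒m≡0 _ eq)
  uncovered≡0⇒≡true X eq (Fin.suc z) =
    uncovered≡0⇒≡true (X ∘ Fin.suc) (ℕ.m+n≡0⇒n≡0 (𝟙 (not (X Fin.zero))) eq) z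

  uncovered+∣p∣≡n : ∀ {n} (p : Subset n) → uncovered (lookup p) + ∣ p ∣ ≡ n
  uncovered+∣p∣≡n []            = refl
  uncovered+∣p∣≡n (outside ∷ p) = cong suc (uncovered+∣p∣≡n p)
  uncovered+∣p∣≡n (inside ∷ p)  = trans (ℕ.+-suc _ ∣ p ∣) (cong suc (uncovered+∣p∣≡n p))

  ∣p∪q∣≤∣p∣+∣q∣ : ∀ {n} (p r : Subset n) → ∣ p ∪ r ∣ ≤ ∣ p ∣ + ∣ r ∣
  ∣p∪q∣≤∣p∣+∣q∣ []            []            = z≤n
  ∣p∪q∣≤∣p∣+∣q∣ (outside ∷ p) (outside ∷ r) = ∣p∪q∣≤∣p∣+∣q∣ p r
  ∣p∪q∣≤∣p∣+∣q∣ (outside ∷ p) (inside ∷ r)  =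
    subst (suc ∣ p ∪ r ∣ ≤_) (sym (ℕ.+-suc ∣ p ∣ ∣ r ∣)) (s≤s (∣p∪q∣≤∣p∣+∣q∣ p r))
  ∣p∪q∣≤∣p∣+∣q∣ (inside ∷ p)  (outside ∷ r) = s≤s (∣p∪q∣≤∣p∣+∣q∣ p r)
  ∣p∪q∣≤∣p∣+∣q∣ (inside ∷ p)  (inside ∷ r)  =
    s≤s (ℕ.≤-trans (∣p∪q∣≤∣p∣+∣q∣ p r) (ℕ.+-monoʳ-≤ ∣ p ∣ (ℕ.n≤1+n ∣ r ∣)))

  ∃[i]n*f[i]≤sum : ∀ {n} .{{_ : NonZero n}} (f : Fin n → ℕ) → ∃ λ i → n * f i ≤ sum f
  ∃[i]n*f[i]≤sum {suc zero}    f = Fin.zero , ℕ.≤-refl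
  ∃[i]n*f[i]≤sum {suc (suc n)} f with ∃[i]n*f[i]≤sum (f ∘ Fin.suc)
  ... | i , n*fi≤sum with f Fin.zero ℕ.≤? f (Fin.suc i)
  ...   | yes f0≤fi =
    Fin.zero , ℕ.+-monoʳ-≤ (f Fin.zero) (ℕ.≤-trans (ℕ.*-monoʳ-≤ (suc n) f0≤fi) n*fi≤sum)
  ...   | no  f0≰fi =
    Fin.suc i , ℕ.+-mono-≤ (ℕ.<⇒≤ (ℕ.≰⇒> f0≰fi)) n*fi≤sum

  ^-distribʳ-* : ∀ m n o → (m * n) ^ o ≡ m ^ o * n ^ o
  ^-distribʳ-* m n zero    = refl
  ^-distribʳ-* m n (suc o) = begin
    m * n * (m * n) ^ o         ≡⟨ cong (m * n *_) (^-distribʳ-* m n o) ⟩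
    m * n * (m ^ o * n ^ o)     ≡⟨ ℕ.*-assoc m n _ ⟩
    m * (n * (m ^ o * n ^ o))   ≡⟨ cong (m *_) (x∙yz≈y∙xz n (m ^ o) (n ^ o)) ⟩
    m * (m ^ o * (n * n ^ o))   ≡⟨ ℕ.*-assoc m (m ^ o) _ ⟨
    m * m ^ o * (n * n ^ o)     ∎
    where open ≡-Reasoning

  [m^n]^o≡m^[o*n] : ∀ m n o → (m ^ n) ^ o ≡ m ^ (o * n)
  [m^n]^o≡m^[o*n] m n o = trans (ℕ.^-*-assoc m n o) (cong (m ^_) (ℕ.*-comm n o))

  m*n≤o<m⇒n≡0 : ∀ {m n o} → m * n ≤ o → o < m → n ≡ 0
  m*n≤o<m⇒n≡0 {m} {zero}  _ _ = refl
  m*n≤o<m⇒n≡0 {m} {suc n} m*n≤o o<m =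
    contradiction (ℕ.≤-trans (ℕ.m≤m*n m (suc n)) m*n≤o) (ℕ.<⇒≱ o<m)

  module _ {q : ℕ} .{{_ : NonZero q}} where

    _⊖_ : Fin q → Fin q → Fin q
    z ⊖ b = fromℕ< (m%n<n (toℕ z + (q ∸ toℕ b)) q)

    [m%q+n]%q≡[m+n]%q : ∀ m n → (m % q + n) % q ≡ (m + n) % q
    [m%q+n]%q≡[m+n]%q m n = begin
      (m % q + n) % q           ≡⟨ %-distribˡ-+ (m % q) n q ⟩
      (m % q % q + n % q) % q   ≡⟨ cong (λ r → (r + n % q) % q) (m%n%n≡m%n m q) ⟩
      (m % q + n % q) % q       ≡⟨ %-distribˡ-+ m n q ⟨
      (m + n) % q               ∎
      where open ≡-Reasoning

    [[x+u]%q+v]%q≡x : ∀ x {u v} → u + v ≡ q → ((toℕ x + u) % q + v) % q ≡ toℕ x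
    [[x+u]%q+v]%q≡x x {u} {v} u+v≡q = begin
      ((toℕ x + u) % q + v) % q   ≡⟨ [m%q+n]%q≡[m+n]%q (toℕ x + u) v ⟩
      (toℕ x + u + v) % q         ≡⟨ cong (_% q) (trans (ℕ.+-assoc (toℕ x) u v) (cong (toℕ x +_) u+v≡q)) ⟩
      (toℕ x + q) % q             ≡⟨ [m+n]%n≡m%n (toℕ x) q ⟩
      toℕ x % q                   ≡⟨ m<n⇒m%n≡m (Fin.toℕ<n x) ⟩
      toℕ x                       ∎
      where open ≡-Reasoning

    ⊖-⊕-cancel : ∀ z b → (z ⊖ b) ⊕ b ≡ z
    ⊖-⊕-cancel z b = Fin.toℕ-injective (begin
      toℕ ((z ⊖ b) ⊕ b)                            ≡⟨ Fin.toℕ-fromℕ< _ ⟩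
      (toℕ (z ⊖ b) + toℕ b) % q                    ≡⟨ cong (λ r → (r + toℕ b) % q) (Fin.toℕ-fromℕ< _) ⟩
      ((toℕ z + (q ∸ toℕ b)) % q + toℕ b) % q      ≡⟨ [[x+u]%q+v]%q≡x z (ℕ.m∸n+n≡m (ℕ.<⇒≤ (Fin.toℕ<n b))) ⟩
      toℕ z                                        ∎)
      where open ≡-Reasoning

    ⊕-⊖-cancel : ∀ x b → (x ⊕ b) ⊖ b ≡ x
    ⊕-⊖-cancel x b = Fin.toℕ-injective (begin
      toℕ ((x ⊕ b) ⊖ b)                            ≡⟨ Fin.toℕ-fromℕ< _ ⟩
      (toℕ (x ⊕ b) + (q ∸ toℕ b)) % q              ≡⟨ cong (λ r → (r + (q ∸ toℕ b)) % q) (Fin.toℕ-fromℕ< _) ⟩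
      ((toℕ x + toℕ b) % q + (q ∸ toℕ b)) % q      ≡⟨ [[x+u]%q+v]%q≡x x (ℕ.m+[n∸m]≡n (ℕ.<⇒≤ (Fin.toℕ<n b))) ⟩
      toℕ x                                        ∎)
      where open ≡-Reasoning

    ⊕-comm : ∀ x y → x ⊕ y ≡ y ⊕ x
    ⊕-comm x y = Fin.toℕ-injective (begin
      toℕ (x ⊕ y)          ≡⟨ Fin.toℕ-fromℕ< _ ⟩
      (toℕ x + toℕ y) % q  ≡⟨ cong (_% q) (ℕ.+-comm (toℕ x) (toℕ y)) ⟩
      (toℕ y + toℕ x) % q  ≡⟨ Fin.toℕ-fromℕ< _ ⟨
      toℕ (y ⊕ x)          ∎)
      where open ≡-Reasoning

    ⊖-involutive : ∀ z b → z ⊖ (z ⊖ b) ≡ b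
    ⊖-involutive z b = begin
      z ⊖ (z ⊖ b)                   ≡⟨ cong (_⊖ (z ⊖ b)) (⊖-⊕-cancel z b) ⟨
      ((z ⊖ b) ⊕ b) ⊖ (z ⊖ b)       ≡⟨ cong (_⊖ (z ⊖ b)) (⊕-comm (z ⊖ b) b) ⟩
      (b ⊕ (z ⊖ b)) ⊖ (z ⊖ b)       ≡⟨ ⊕-⊖-cancel b (z ⊖ b) ⟩
      b                             ∎
      where open ≡-Reasoning

    sum-translate : ∀ z (f : Fin q → ℕ) → sum (λ b → f (z ⊖ b)) ≡ sum f
    sum-translate z f =
      sym (∑-permute f (permutation (z ⊖_) (z ⊖_) (⊖-involutive z) (⊖-involutive z)))

    _∪[_+_] : (Fin q → Bool) → (Fin q → Bool) → Fin q → Fin q → Bool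
    (Y ∪[ X + b ]) z = Y z ∨ X (z ⊖ b)

    sum-uncovered-∪-translates : ∀ Y X →
                                 sum (λ b → uncovered (Y ∪[ X + b ])) ≡ uncovered Y * uncovered X
    sum-uncovered-∪-translates Y X = begin
      sum (λ b → sum (λ z → 𝟙 (not (Y z ∨ X (z ⊖ b)))))
        ≡⟨ sum-cong-≗ (λ b → sum-cong-≗ (λ z → 𝟙-not-∨ (Y z) (X (z ⊖ b)))) ⟩
      sum (λ b → sum (λ z → 𝟙 (not (Y z)) * 𝟙 (not (X (z ⊖ b)))))
        ≡⟨ ∑-comm (λ b z → 𝟙 (not (Y z)) * 𝟙 (not (X (z ⊖ b)))) ⟩
      sum (λ z → sum (λ b → 𝟙 (not (Y z)) * 𝟙 (not (X (z ⊖ b)))))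
        ≡⟨ sum-cong-≗ (λ z → *-distribˡ-sum (𝟙 (not (Y z))) (λ b → 𝟙 (not (X (z ⊖ b))))) ⟨
      sum (λ z → 𝟙 (not (Y z)) * sum (λ b → 𝟙 (not (X (z ⊖ b)))))
        ≡⟨ sum-cong-≗ (λ z → cong (𝟙 (not (Y z)) *_) (sum-translate z (λ x → 𝟙 (not (X x))))) ⟩
      sum (λ z → 𝟙 (not (Y z)) * uncovered X)
        ≡⟨ *-distribʳ-sum (uncovered X) (λ z → 𝟙 (not (Y z))) ⟨
      uncovered Y * uncovered X ∎
      where open ≡-Reasoning

    ∃-good-translate : ∀ Y X → ∃ λ b → q * uncovered (Y ∪[ X + b ]) ≤ uncovered Y * uncovered X
    ∃-good-translate Y X with ∃[i]n*f[i]≤sum (λ b → uncovered (Y ∪[ X + b ]))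
    ... | b , q*u≤sum = b , ℕ.≤-trans q*u≤sum (ℕ.≤-reflexive (sum-uncovered-∪-translates Y X))

    Sumset : (Fin q → Bool) → Subset q → Fin q → Set
    Sumset X B z = ∃ λ x → ∃ λ b → X x ≡ true × b ∈ B × z ≡ x ⊕ b

    ∪-translate-⊆ : ∀ {X Y B} b → (∀ z → Y z ≡ true → Sumset X B z) →
                    ∀ z → (Y ∪[ X + b ]) z ≡ true → Sumset X (B ∪ ⁅ b ⁆) z
    ∪-translate-⊆ {Y = Y} b Y⊆X+B z _ with Y z in Yz≡true
    ∪-translate-⊆ b Y⊆X+B z _ | true with Y⊆X+B z Yz≡true
    ... | x , b′ , Xx , b′∈B , z≡x⊕b′ = x , b′ , Xx , x∈p∪q⁺ (inj₁ b′∈B) , z≡x⊕b′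
    ∪-translate-⊆ b Y⊆X+B z X[z⊖b] | false =
      z ⊖ b , b , X[z⊖b] , x∈p∪q⁺ (inj₂ (x∈⁅x⁆ b)) , sym (⊖-⊕-cancel z b)

    greedy-bound : ∀ {j u v c} → q ^ j * u ≤ q * c ^ j → q * v ≤ u * c → q ^ suc j * v ≤ q * c ^ suc j
    greedy-bound {j} {u} {v} {c} q^j*u≤q*c^j q*v≤u*c = begin
      q * q ^ j * v      ≡⟨ xy∙z≈y∙xz q (q ^ j) v ⟩
      q ^ j * (q * v)    ≤⟨ ℕ.*-monoʳ-≤ (q ^ j) q*v≤u*c ⟩
      q ^ j * (u * c)    ≡⟨ ℕ.*-assoc (q ^ j) u c ⟨
      q ^ j * u * c      ≤⟨ ℕ.*-monoˡ-≤ c q^j*u≤q*c^j ⟩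
      q * c ^ j * c      ≡⟨ xy∙z≈x∙zy q (c ^ j) c ⟩
      q * (c * c ^ j)    ∎
      where open ℕ.≤-Reasoning

    record Cover (X : Fin q → Bool) (j : ℕ) : Set where
      field
        shifts    : Subset q
        covered   : Fin q → Bool
        ∣shifts∣≤j : ∣ shifts ∣ ≤ j
        covered⊆X+shifts : ∀ z → covered z ≡ true → Sumset X shifts z
        -- u(covered) / q ≤ (u(X) / q)^j with the denominators cleared
        bound     : q ^ j * uncovered covered ≤ q * uncovered X ^ j

    greedy : ∀ X j → Cover X j
    greedy X zero = record
      { shifts           = ⊥
      ; covered          = λ _ → false
      ; ∣shifts∣≤j        = ℕ.≤-reflexive (∣⊥∣≡0 q)
      ; covered⊆X+shifts = λ _ ()
      ; bound            = subst₂ _≤_ (sym (ℕ.*-identityˡ _)) (sym (ℕ.*-identityʳ q)) (uncovered≤n _)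
      }
    greedy X (suc j) = record
      { shifts           = shifts ∪ ⁅ b ⁆
      ; covered          = covered ∪[ X + b ]
      ; ∣shifts∣≤j        = ∣shifts∪⁅b⁆∣≤1+j
      ; covered⊆X+shifts = ∪-translate-⊆ b covered⊆X+shifts
      ; bound            = greedy-bound {j} {c = uncovered X} bound (proj₂ good)
      }
      where
      open Cover (greedy X j)
      good : ∃ λ b → q * uncovered (covered ∪[ X + b ]) ≤ uncovered covered * uncovered X
      good = ∃-good-translate covered X
      b : Fin q
      b = proj₁ good
      ∣shifts∪⁅b⁆∣≤1+j : ∣ shifts ∪ ⁅ b ⁆ ∣ ≤ suc j
      ∣shifts∪⁅b⁆∣≤1+j = begin
        ∣ shifts ∪ ⁅ b ⁆ ∣          ≤⟨ ∣p∪q∣≤∣p∣+∣q∣ shifts ⁅ b ⁆ ⟩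
        ∣ shifts ∣ + ∣ ⁅ b ⁆ ∣      ≡⟨ cong (∣ shifts ∣ +_) (∣⁅x⁆∣≡1 b) ⟩
        ∣ shifts ∣ + 1              ≤⟨ ℕ.+-monoˡ-≤ 1 ∣shifts∣≤j ⟩
        j + 1                       ≡⟨ ℕ.+-comm j 1 ⟩
        suc j                       ∎
        where open ℕ.≤-Reasoning

    iterate-bound : ∀ {m N u v c} → q ^ N * u ≤ q * c ^ N → q ^ m * v ≤ q * u ^ m →
                    q ^ (m * N) * v ≤ q * c ^ (m * N)
    iterate-bound {m} {N} {u} {v} {c} q^N*u≤q*c^N q^m*v≤q*u^m =
      ℕ.*-cancelˡ-≤ (q ^ m) {{ℕ.m^n≢0 q m}} (begin
      q ^ m * (q ^ (m * N) * v)      ≡⟨ x∙yz≈y∙xz (q ^ m) (q ^ (m * N)) v ⟩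
      q ^ (m * N) * (q ^ m * v)      ≡⟨ cong (_* (q ^ m * v)) ([m^n]^o≡m^[o*n] q N m) ⟨
      (q ^ N) ^ m * (q ^ m * v)      ≤⟨ ℕ.*-monoʳ-≤ ((q ^ N) ^ m) q^m*v≤q*u^m ⟩
      (q ^ N) ^ m * (q * u ^ m)      ≡⟨ x∙yz≈y∙xz ((q ^ N) ^ m) q (u ^ m) ⟩
      q * ((q ^ N) ^ m * u ^ m)      ≡⟨ cong (q *_) (^-distribʳ-* (q ^ N) u m) ⟨
      q * (q ^ N * u) ^ m            ≤⟨ ℕ.*-monoʳ-≤ q (ℕ.^-monoˡ-≤ m q^N*u≤q*c^N) ⟩
      q * (q * c ^ N) ^ m            ≡⟨ cong (q *_) (^-distribʳ-* q (c ^ N) m) ⟩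
      q * (q ^ m * (c ^ N) ^ m)      ≡⟨ x∙yz≈y∙xz q (q ^ m) ((c ^ N) ^ m) ⟩
      q ^ m * (q * (c ^ N) ^ m)      ≡⟨ cong (λ r → q ^ m * (q * r)) ([m^n]^o≡m^[o*n] c N m) ⟩
      q ^ m * (q * c ^ (m * N))      ∎)
      where open ℕ.≤-Reasoning

    record IteratedCover (A : Subset q) (m i : ℕ) : Set where
      field
        shifts    : Fin i → Subset q
        covered   : Fin q → Bool
        ∣shifts∣≤m : ∀ l → ∣ shifts l ∣ ≤ m
        covered⊆A+shifts : ∀ z → covered z ≡ true → InSumset i A shifts z
        bound     : q ^ (m ^ i) * uncovered covered ≤ q * uncovered (lookup A) ^ (m ^ i)

    iteratedCover : ∀ A m i → IteratedCover A m i
    iteratedCover A m zero = record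
      { shifts           = λ ()
      ; covered          = lookup A
      ; ∣shifts∣≤m        = λ ()
      ; covered⊆A+shifts = λ z → lookup⇒[]= z A
      ; bound            = ℕ.≤-reflexive (xy∙z≈x∙zy q 1 (uncovered (lookup A)))
      }
    iteratedCover A m (suc i) = record
      { shifts           = Cover.shifts C Vector.∷ shifts
      ; covered          = Cover.covered C
      ; ∣shifts∣≤m        = λ { Fin.zero → Cover.∣shifts∣≤j C ; (Fin.suc l) → ∣shifts∣≤m l }
      ; covered⊆A+shifts = λ z z∈C → extend (Cover.covered⊆X+shifts C z z∈C)
      ; bound            = iterate-bound {m} bound (Cover.bound C)
      }
      where
      open IteratedCover (iteratedCover A m i)
      C : Cover covered m
      C = greedy covered m
      extend : ∀ {z} → Sumset covered (Cover.shifts C) z →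
               InSumset (suc i) A (Cover.shifts C Vector.∷ shifts) z
      extend (x , b , x∈covered , b∈C , z≡x⊕b) = x , b , covered⊆A+shifts x x∈covered , b∈C , z≡x⊕b

open import Defs
open import Data.Nat using (ℕ; NonZero; _≤_; _^_)
open import Data.Rational using (ℚ; 0ℚ; 1ℚ; _<_; _*_) renaming (_≤_ to _≤ℚ_)
open import Data.Fin using (Fin)
open import Data.Fin.Subset using (Subset; Nonempty; ∣_∣)
open import Data.Product using (Σ; _×_; _,_)
open import Data.Bool using (true)
open import Relation.Binary.PropositionalEquality using (_≡_)
open Exponential using (q*c^N<q^N)
open Covering

lemma7 : (q : ℕ) .{{_ : NonZero q}} → 2 ≤ q →
         (A : Subset q) → Nonempty A →
         (t : ℚ) → 0ℚ < t → t < 1ℚ → t * ℕtoℚ q ≤ℚ ℕtoℚ ∣ A ∣ →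
         (k : ℕ) → 1 ≤ k →
         (m : ℕ) → LogLe q (t * ℕtoℚ (m ^ k)) →
         Σ (Fin k → Subset q) (λ B →
           ((i : Fin k) → ∣ B i ∣ ≤ m) ×
           ((z : Fin q) → InSumset k A B z))
lemma7 q 2≤q A _ t 0<t t<1 tq≤∣A∣ k _ m logq≤tmᵏ =
  shifts , ∣shifts∣≤m , λ z → covered⊆A+shifts z (all-covered z)
  where
  open IteratedCover (iteratedCover A m k)
  all-covered : ∀ z → covered z ≡ true
  all-covered = uncovered≡0⇒≡true covered (m*n≤o<m⇒n≡0 bound
    (q*c^N<q^N (m ^ k) 2≤q (uncovered+∣p∣≡n A) 0<t t<1 tq≤∣A∣ logq≤tmᵏ))
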